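{- Let $p$ be an odd prime, $m$ a positive integer, $M=\mathbb F_{p^m}$, $q=p^k$ with $1\le k\le m-1$ and $m/\gcd(k,m)$ odd. Let $f,g:M\to M$ be $\mathbb F_p$-linear maps such that for each $w\in M$ there is $u_w\in M$ with $f(x^qu_w+xu_w^q)=g(x)^qw+g(x)w^q$ for all $x\in M$. Then $w\mapsto u_w$ is a bijection of $M$, or $g=0$. -}

module Defs where

open import Level using (_⊔_)
open import Data.Nat using (ℕ)
open import Data.Fin using (Fin)
open import Data.Product using (∃; _×_)
open import Relation.Nullary using (¬_)
open import Relation.Binary.PropositionalEquality renaming (setoid to ≡-setoid)
open import Function.Bundles using (Bijection)
open import Algebra.Bundles using (CommutativeRing)
import Algebra.Definitions.RawMonoid as RM

module _ {c ℓ} (R : CommutativeRing c ℓ) where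
  open CommutativeRing R

  _^_ : Carrier → ℕ → Carrier
  x ^ n = RM._×_ *-rawMonoid n x

  _·_ : ℕ → Carrier → Carrier
  n · x = RM._×_ +-rawMonoid n x

  IsField : Set (c ⊔ ℓ)
  IsField = (¬ (1# ≈ 0#)) × (∀ x → ¬ (x ≈ 0#) → ∃ λ y → x * y ≈ 1#)

  HasCard : ℕ → Set (c ⊔ ℓ)
  HasCard N = Bijection setoid (≡-setoid (Fin N))

  -- F_p-linear (over the prime field, whose elements are the n · 1, n ∈ ℕ)
  -- endomorphism of R: respects equality, additive, commutes with scalars
  IsFpLinear : (Carrier → Carrier) → Set (c ⊔ ℓ)
  IsFpLinear f = (∀ {x y} → x ≈ y → f x ≈ f y)
               × (∀ x y → f (x + y) ≈ f x + f y)
               × (∀ (n : ℕ) x → f (n · x) ≈ n · f x)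

-- Write q = p ^ k and frob k x = x ^ q. As M has characteristic p, frob k is additive, and
-- frob m is the identity (Fermat's little theorem for the field M of order p ^ m). The
-- hypothesis reads f (twist x (u w)) = twist (g x) w, where twist a v = a ^ q * v + a * v ^ q.
-- If a = g x ≠ 0 then twist a is injective: substituting v = a * s gives
-- twist a v = (a * a ^ q) * (s + frob k s), so twist a v = 0 forces frob k s = - s. Then
-- frob (j * k) s = ± s for every j, hence frob d s = ± s for d = gcd k m by Bézout and
-- frob m = id. If frob d s = s then frob k s = s as d ∣ k; if frob d s = - s then
-- frob m s = - s as m / d is odd. Either way s = - s, so s = 0 because p is odd. Hence u is
-- injective, and so bijective since M is finite.

module Submission where

open import Defs using (IsField; HasCard; IsFpLinear)
open import Data.Nat as ℕ using (ℕ; zero; suc; _≤_; _<_; _∸_; _!; z≤n; s≤s)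
  renaming (_*_ to _*ℕ_; _^_ to _^ℕ_)
import Data.Nat.Properties as ℕ
open import Data.Nat.Combinatorics using (_C_; nCn≡1; nCk≡n!/k![n-k]!; k![n∸k]!∣n!)
open import Data.Nat.DivMod using (_%_; _/_; m≡m%n+[m/n]*n; m%n<n; m/n*n≡m)
open import Data.Nat.Divisibility using (_∣_; divides; ∣-refl; m%n≡0⇒n∣m; m∣m*n; ∣⇒≤)
open import Data.Nat.GCD using (gcd; gcd[m,n]∣m; gcd-GCD; module GCD; module Bézout)
open import Data.Nat.Primality using (Prime; euclidsLemma; prime⇒nonTrivial)
open import Data.Fin as Fin using (Fin; zero; suc; punchOut; toℕ; inject₁; fromℕ)
import Data.Fin.Properties as Fin
open import Data.Fin.Permutation using (Permutation; permutation; _⟨$⟩ʳ_; remove; punchIn-permute)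
open import Data.Product using (∃; _×_; _,_; proj₁; proj₂)
import Data.Product as Product
open import Data.Sum using (_⊎_; inj₁; inj₂; map; map₁)
open import Function using (id; _∘_)
open import Function.Bundles using (Bijection; Surjection)
open import Function.Definitions
  using (Injective; Bijective; Congruent; StrictlyInverseˡ; StrictlyInverseʳ)
open import Relation.Nullary using (¬_; Dec; yes; no)
open import Relation.Nullary.Decidable using (map′)
open import Relation.Nullary.Negation using (contradiction)
open import Relation.Binary.PropositionalEquality as ≡ using (_≡_)
open import Algebra.Bundles using (Monoid; CommutativeMonoid; CommutativeSemiring; CommutativeRing)

prime>1 : ∀ {p} → Prime p → 1 < p
prime>1 {p} p-prime = ℕ.nonTrivial⇒n>1 p ⦃ prime⇒nonTrivial p-prime ⦄

prime∤! : ∀ {p} → Prime p → ∀ {i} → i < p → ¬ p ∣ i !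
prime∤! p-prime {zero}  i<p p∣1 = contradiction (∣⇒≤ p∣1) (ℕ.<⇒≱ (prime>1 p-prime))
prime∤! p-prime {suc i} i<p p∣[1+i]! with euclidsLemma (suc i) (i !) p-prime p∣[1+i]!
... | inj₁ p∣1+i = contradiction (∣⇒≤ p∣1+i) (ℕ.<⇒≱ i<p)
... | inj₂ p∣i!  = prime∤! p-prime (ℕ.<-trans (ℕ.n<1+n i) i<p) p∣i!

prime∣C : ∀ {p} → Prime p → ∀ {j} → 0 < j → j < p → p ∣ p C j
prime∣C {p@(suc p-1)} p-prime {j} 0<j j<p
  with euclidsLemma (p C j) (j ! *ℕ (p ∸ j) !) p-prime p∣C*denominator
  where
  j≤p : j ≤ p
  j≤p = ℕ.<⇒≤ j<p
  p∣C*denominator : p ∣ (p C j) *ℕ (j ! *ℕ (p ∸ j) !)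
  p∣C*denominator = ≡.subst (p ∣_) (≡.sym (≡.trans
    (≡.cong (_*ℕ (j ! *ℕ (p ∸ j) !)) (nCk≡n!/k![n-k]! j≤p))
    (m/n*n≡m ⦃ ℕ._!*_!≢0 j (p ∸ j) ⦄ (k![n∸k]!∣n! j≤p))))
    (m∣m*n (p-1 !))
... | inj₁ p∣C = p∣C
... | inj₂ p∣denominator with euclidsLemma (j !) ((p ∸ j) !) p-prime p∣denominator
...   | inj₁ p∣j!     = contradiction p∣j! (prime∤! p-prime j<p)
...   | inj₂ p∣[p-j]! = contradiction p∣[p-j]! (prime∤! p-prime (ℕ.∸-monoʳ-< 0<j (ℕ.<⇒≤ j<p)))

¬2∣n⇒n≡1+[n/2]*2 : ∀ {n} → ¬ 2 ∣ n → n ≡ suc (n / 2 *ℕ 2)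
¬2∣n⇒n≡1+[n/2]*2 {n} 2∤n with n % 2 in n%2≡ | m≡m%n+[m/n]*n n 2 | m%n<n n 2
... | 0           | _           | _                = contradiction (m%n≡0⇒n∣m n 2 n%2≡) 2∤n
... | 1           | n≡1+[n/2]*2 | _                = n≡1+[n/2]*2
... | suc (suc _) | _           | s≤s (s≤s ())

Fin-injective⇒surjective : ∀ {n} (f : Fin n → Fin n) → Injective _≡_ _≡_ f → ∀ y → ∃ λ i → f i ≡ y
Fin-injective⇒surjective {suc n} f f-inj y with Fin.any? (λ i → f i Fin.≟ y)
... | yes hit = hit
... | no miss = contradiction (Fin.injective⇒≤ {f = f-avoiding-y} f-avoiding-y-injective) ℕ.1+n≰n
  where
  f≢y : ∀ i → y ≡.≢ f i
  f≢y i y≡fi = miss (i , ≡.sym y≡fi)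
  f-avoiding-y : Fin (suc n) → Fin n
  f-avoiding-y i = punchOut (f≢y i)
  f-avoiding-y-injective : Injective _≡_ _≡_ f-avoiding-y
  f-avoiding-y-injective {i} {j} eq = f-inj (Fin.punchOut-injective (f≢y i) (f≢y j) eq)

module _ {c ℓ} (G : CommutativeMonoid c ℓ) where
  open CommutativeMonoid G
  open import Algebra.Properties.CommutativeMonoid.Sum G
  open import Algebra.Definitions.RawMonoid rawMonoid using () renaming (_×_ to _·_)
  open import Relation.Binary.Reasoning.Setoid setoid

  ∑-translate : ∀ {n} (h : Fin n → Carrier) (π : Permutation n n) (t : Carrier)
              → (∀ i → h (π ⟨$⟩ʳ i) ≈ t ∙ h i) → sum h ≈ (n · t) ∙ sum h
  ∑-translate {n} h π t h∘π≈t∙h = begin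
    sum h                      ≈⟨ ∑-permute h π ⟩
    sum (λ i → h (π ⟨$⟩ʳ i))   ≈⟨ sum-cong-≋ {n} h∘π≈t∙h ⟩
    sum (λ i → t ∙ h i)        ≈⟨ ∑-distrib-+ (λ _ → t) h ⟩
    sum {n} (λ _ → t) ∙ sum h  ≈⟨ ∙-congʳ (sum-replicate n) ⟩
    (n · t) ∙ sum h            ∎

module _ {c ℓ} (G : Monoid c ℓ) where
  open Monoid G
  open import Algebra.Properties.Monoid.Sum G using (sum; sum-init-last; sum-cong-≋; sum-replicate-zero)
  open import Relation.Binary.Reasoning.Setoid setoid

  ∑-ends : ∀ k (h : ℕ → Carrier) → (∀ j → 0 < j → j < suc k → h j ≈ ε)
         → sum {suc (suc k)} (λ i → h (toℕ i)) ≈ h 0 ∙ h (suc k)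
  ∑-ends k h h-inner≈ε = ∙-congˡ (begin
    sum {suc k} (λ i → h (suc (toℕ i)))
      ≈⟨ sum-init-last {k} (λ i → h (suc (toℕ i))) ⟩
    sum {k} (λ i → h (suc (toℕ (inject₁ i)))) ∙ h (suc (toℕ (fromℕ k)))
      ≈⟨ ∙-cong inner≈ε (reflexive (≡.cong (h ∘ suc) (Fin.toℕ-fromℕ k))) ⟩
    ε ∙ h (suc k)
      ≈⟨ identityˡ _ ⟩
    h (suc k)
      ∎)
    where
    inner≈ε : sum {k} (λ i → h (suc (toℕ (inject₁ i)))) ≈ ε
    inner≈ε = trans (sum-cong-≋ λ i → h-inner≈ε _ (s≤s z≤n)
                       (s≤s (≡.subst (_< k) (≡.sym (Fin.toℕ-inject₁ i)) (Fin.toℕ<n i))))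
                    (sum-replicate-zero k)

module _ {c ℓ} (S : CommutativeSemiring c ℓ) where
  open CommutativeSemiring S
  open import Algebra.Properties.CommutativeSemiring.Exp S using (_^_)
  open import Algebra.Properties.CommutativeSemiring.Binomial S using () renaming (theorem to binomial-theorem)
  open import Algebra.Properties.Semiring.Mult semiring using () renaming (_×_ to _·_)
  open import Relation.Binary.Reasoning.Setoid setoid

  freshmans-dream : ∀ q → 0 < q → (∀ j → 0 < j → j < q → ∀ z → (q C j) · z ≈ 0#)
                  → ∀ x y → (x + y) ^ q ≈ x ^ q + y ^ q
  freshmans-dream q@(suc k) _ inner≈0 x y = begin
    (x + y) ^ q                          ≈⟨ binomial-theorem q x y ⟩
    sum {suc q} (λ i → term (toℕ i))     ≈⟨ ∑-ends +-monoid k term (λ j 0<j j<q → inner≈0 j 0<j j<q _) ⟩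
    term 0 + term q                      ≈⟨ +-cong (trans (+-identityʳ _) (*-identityˡ _)) last≈x^q ⟩
    y ^ q + x ^ q                        ≈⟨ +-comm _ _ ⟩
    x ^ q + y ^ q                        ∎
    where
    open import Algebra.Properties.Monoid.Sum +-monoid using (sum)
    term : ℕ → Carrier
    term j = (q C j) · (x ^ j * y ^ (q ∸ j))
    last≈x^q : term q ≈ x ^ q
    last≈x^q = begin
      (q C q) · (x ^ q * y ^ (q ∸ q))  ≡⟨ ≡.cong₂ (λ a b → a · (x ^ q * y ^ b)) (nCn≡1 q) (ℕ.n∸n≡0 q) ⟩
      1 · (x ^ q * 1#)                 ≈⟨ +-identityʳ _ ⟩
      x ^ q * 1#                       ≈⟨ *-identityʳ _ ⟩
      x ^ q                            ∎

module FieldProperties {c ℓ} (M : CommutativeRing c ℓ) (isField : IsField M) where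
  open CommutativeRing M
  open import Algebra.Properties.CommutativeSemiring.Exp commutativeSemiring using (_^_)
  open import Relation.Binary.Reasoning.Setoid setoid

  1≉0 : 1# ≉ 0#
  1≉0 = proj₁ isField

  inverse : ∀ x → x ≉ 0# → Carrier
  inverse x x≉0 = proj₁ (proj₂ isField x x≉0)

  *-inverseʳ : ∀ x (x≉0 : x ≉ 0#) → x * inverse x x≉0 ≈ 1#
  *-inverseʳ x x≉0 = proj₂ (proj₂ isField x x≉0)

  *-inverseˡ : ∀ x (x≉0 : x ≉ 0#) → inverse x x≉0 * x ≈ 1#
  *-inverseˡ x x≉0 = trans (*-comm _ x) (*-inverseʳ x x≉0)

  x*[x⁻¹*y]≈y : ∀ {x} (x≉0 : x ≉ 0#) y → x * (inverse x x≉0 * y) ≈ y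
  x*[x⁻¹*y]≈y {x} x≉0 y = begin
    x * (inverse x x≉0 * y)  ≈⟨ *-assoc x _ y ⟨
    (x * inverse x x≉0) * y  ≈⟨ *-congʳ (*-inverseʳ x x≉0) ⟩
    1# * y                   ≈⟨ *-identityˡ y ⟩
    y                        ∎

  x⁻¹*[x*y]≈y : ∀ {x} (x≉0 : x ≉ 0#) y → inverse x x≉0 * (x * y) ≈ y
  x⁻¹*[x*y]≈y {x} x≉0 y = begin
    inverse x x≉0 * (x * y)  ≈⟨ *-assoc _ x y ⟨
    (inverse x x≉0 * x) * y  ≈⟨ *-congʳ (*-inverseˡ x x≉0) ⟩
    1# * y                   ≈⟨ *-identityˡ y ⟩
    y                        ∎

  *-cancelˡ : ∀ {x y z} → x ≉ 0# → x * y ≈ x * z → y ≈ z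
  *-cancelˡ {x} {y} {z} x≉0 xy≈xz =
    trans (sym (x⁻¹*[x*y]≈y x≉0 y)) (trans (*-congˡ xy≈xz) (x⁻¹*[x*y]≈y x≉0 z))

  *-nonzero : ∀ {x y} → x ≉ 0# → y ≉ 0# → x * y ≉ 0#
  *-nonzero {x} {y} x≉0 y≉0 xy≈0 = y≉0 (*-cancelˡ x≉0 (trans xy≈0 (sym (zeroʳ x))))

  ^-nonzero : ∀ {x} → x ≉ 0# → ∀ k → x ^ k ≉ 0#
  ^-nonzero x≉0 zero    = 1≉0
  ^-nonzero x≉0 (suc k) = *-nonzero x≉0 (^-nonzero x≉0 k)

module FiniteFieldProperties {c ℓ} (M : CommutativeRing c ℓ) (isField : IsField M)
                             {n : ℕ} (card : HasCard M (suc n)) where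
  open CommutativeRing M hiding (zero)
  open FieldProperties M isField
  open import Algebra.Properties.CommutativeSemiring.Exp commutativeSemiring using (_^_)
  open import Algebra.Properties.Semiring.Mult semiring using () renaming (_×_ to _·_)
  open import Algebra.Properties.Ring ring using (+-identityˡ-unique)
  open import Algebra.Properties.Group +-group using (\\-leftDividesˡ; \\-leftDividesʳ)
  open import Algebra.Properties.CommutativeMonoid.Sum *-commutativeMonoid using () renaming (sum to product)
  open import Relation.Binary.Reasoning.Setoid setoid
  open Bijection card using () renaming (to to index)
  open Surjection (Bijection.surjection card) using () renaming (to⁻ to element; to∘to⁻ to index-element)

  element-index : ∀ x → element (index x) ≈ x
  element-index x = Bijection.injective card (index-element (index x))

  _≟_ : ∀ x y → Dec (x ≈ y)
  x ≟ y = map′ (Bijection.injective card) (Bijection.cong card) (index x Fin.≟ index y)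

  ∃-nonzero⊎zero : (g : Carrier → Carrier) → Congruent _≈_ _≈_ g → (∃ λ x → g x ≉ 0#) ⊎ (∀ x → g x ≈ 0#)
  ∃-nonzero⊎zero g g-cong with Fin.all? (λ i → g (element i) ≟ 0#)
  ... | yes g≈0 = inj₂ λ x → trans (g-cong (sym (element-index x))) (g≈0 (index x))
  ... | no ¬g≈0 = inj₁ (Product.map element id (Fin.¬∀⟶∃¬ (suc n) _ (λ i → g (element i) ≟ 0#) ¬g≈0))

  injective⇒bijective : (h : Carrier → Carrier) → Congruent _≈_ _≈_ h → Injective _≈_ _≈_ h → Bijective _≈_ _≈_ h
  injective⇒bijective h h-cong h-inj = h-inj , surjective
    where
    h̃ : Fin (suc n) → Fin (suc n)
    h̃ i = index (h (element i))
    h̃-inj : Injective _≡_ _≡_ h̃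
    h̃-inj {i} {j} eq = ≡.trans (≡.sym (index-element i))
      (≡.trans (Bijection.cong card (h-inj (Bijection.injective card eq))) (index-element j))
    surjective : ∀ y → ∃ λ x → ∀ {z} → z ≈ x → h z ≈ y
    surjective y with Fin-injective⇒surjective h̃ h̃-inj (index y)
    ... | i , h̃i≡y = element i , λ z≈x → trans (h-cong z≈x) (Bijection.injective card h̃i≡y)

  permutationOf : (h h⁻¹ : Carrier → Carrier) → Congruent _≈_ _≈_ h → Congruent _≈_ _≈_ h⁻¹
                → StrictlyInverseˡ _≈_ h h⁻¹ → StrictlyInverseʳ _≈_ h h⁻¹ → Permutation (suc n) (suc n)
  permutationOf h h⁻¹ h-cong h⁻¹-cong h∘h⁻¹ h⁻¹∘h = permutation
    (λ i → index (h (element i))) (λ i → index (h⁻¹ (element i)))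
    (λ i → ≡.trans (Bijection.cong card (trans (h-cong (element-index _)) (h∘h⁻¹ _))) (index-element i))
    (λ i → ≡.trans (Bijection.cong card (trans (h⁻¹-cong (element-index _)) (h⁻¹∘h _))) (index-element i))

  -- Translation by x permutes M, so ∑ M = (suc n) · x + ∑ M; similarly, multiplication by
  -- x ≉ 0# permutes the n nonzero elements, whose product P thus satisfies P = x ^ n * P.
  card·x≈0 : ∀ x → suc n · x ≈ 0#
  card·x≈0 x = +-identityˡ-unique (suc n · x) ∑ (sym (∑-translate +-commutativeMonoid element π x
    (λ i → element-index (x + element i))))
    where
    open import Algebra.Properties.CommutativeMonoid.Sum +-commutativeMonoid using (sum)
    ∑ : Carrier
    ∑ = sum element
    π : Permutation (suc n) (suc n)
    π = permutationOf (x +_) (- x +_) +-congˡ +-congˡ (\\-leftDividesˡ x) (\\-leftDividesʳ x)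

  private
    nonzero : Fin n → Carrier
    nonzero j = element (Fin.punchIn (index 0#) j)

    nonzero-≉0 : ∀ j → nonzero j ≉ 0#
    nonzero-≉0 j nonzero≈0 = Fin.punchInᵢ≢i (index 0#) j
      (≡.trans (≡.sym (index-element _)) (Bijection.cong card nonzero≈0))

    ∏-nonzero : ∀ {k} (h : Fin k → Carrier) → (∀ i → h i ≉ 0#) → product h ≉ 0#
    ∏-nonzero {zero}  h h≉0 = 1≉0
    ∏-nonzero {suc k} h h≉0 = *-nonzero (h≉0 zero) (∏-nonzero (λ i → h (suc i)) (λ i → h≉0 (suc i)))

  x^n≈1 : ∀ {x} → x ≉ 0# → x ^ n ≈ 1#
  x^n≈1 {x} x≉0 = sym (*-cancelˡ (∏-nonzero nonzero nonzero-≉0) (begin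
      ∏ * 1#        ≈⟨ *-identityʳ ∏ ⟩
      ∏             ≈⟨ ∑-translate *-commutativeMonoid nonzero ρ x scale-nonzero ⟩
      x ^ n * ∏     ≈⟨ *-comm _ ∏ ⟩
      ∏ * x ^ n     ∎))
    where
    ∏ : Carrier
    ∏ = product nonzero
    π : Permutation (suc n) (suc n)
    π = permutationOf (x *_) (inverse x x≉0 *_) *-congˡ *-congˡ (x*[x⁻¹*y]≈y x≉0) (x⁻¹*[x*y]≈y x≉0)
    π-fixes-0 : π ⟨$⟩ʳ index 0# ≡ index 0#
    π-fixes-0 = Bijection.cong card (trans (*-congˡ (element-index 0#)) (zeroʳ x))
    ρ : Permutation n n
    ρ = remove (index 0#) π
    scale-nonzero : ∀ j → nonzero (ρ ⟨$⟩ʳ j) ≈ x * nonzero j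
    scale-nonzero j = trans (reflexive (≡.cong element (≡.trans
        (≡.cong (λ z → Fin.punchIn z (ρ ⟨$⟩ʳ j)) (≡.sym π-fixes-0))
        (≡.sym (punchIn-permute π (index 0#) j)))))
      (element-index _)

  fermat : ∀ x → x ^ suc n ≈ x
  fermat x with x ≟ 0#
  ... | yes x≈0 = trans (*-congʳ x≈0) (trans (zeroˡ _) (sym x≈0))
  ... | no x≉0  = trans (*-congˡ (x^n≈1 x≉0)) (*-identityʳ x)

module Frobenius {c ℓ} (M : CommutativeRing c ℓ) (isField : IsField M) {n : ℕ} (card : HasCard M (suc n))
                 {p : ℕ} (p-prime : Prime p) (m : ℕ) (p^m≡1+n : p ^ℕ m ≡ suc n) where
  open CommutativeRing M hiding (zero)
  open FieldProperties M isField
  open FiniteFieldProperties M isField card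
  open import Algebra.Properties.CommutativeSemiring.Exp commutativeSemiring using (_^_; ^-congˡ; ^-assocʳ; ^-distrib-*)
  open import Algebra.Properties.Semiring.Mult semiring
    using (×1-homo-*; ×-assoc-*; ×-congʳ; ×-assocˡ) renaming (_×_ to _·_)
  open import Algebra.Properties.Ring ring
    using (x+x≈x⇒x≈0; +-inverseʳ-unique; -‿involutive; -‿+-comm; x[y-z]≈xy-xz; x∙y⁻¹≈ε⇒x≈y; x≈y⇒x∙y⁻¹≈ε)
  open import Algebra.Properties.CommutativeSemigroup *-commutativeSemigroup using (x∙yz≈yx∙z)
  open import Algebra.Properties.CommutativeSemigroup +-commutativeSemigroup using (interchange)
  open import Relation.Binary.Reasoning.Setoid setoid

  p^e·1≈[p·1]^e : ∀ e → (p ^ℕ e) · 1# ≈ (p · 1#) ^ e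
  p^e·1≈[p·1]^e zero    = +-identityʳ 1#
  p^e·1≈[p·1]^e (suc e) = trans (×1-homo-* p (p ^ℕ e)) (*-congˡ (p^e·1≈[p·1]^e e))

  p·1≈0 : p · 1# ≈ 0#
  p·1≈0 with (p · 1#) ≟ 0#
  ... | yes p·1≈0 = p·1≈0
  ... | no  p·1≉0 = contradiction (begin
    (p · 1#) ^ m   ≈⟨ p^e·1≈[p·1]^e m ⟨
    (p ^ℕ m) · 1#  ≡⟨ ≡.cong (_· 1#) p^m≡1+n ⟩
    suc n · 1#     ≈⟨ card·x≈0 1# ⟩
    0#             ∎) (^-nonzero p·1≉0 m)

  p∣a⇒a·x≈0 : ∀ {a} → p ∣ a → ∀ x → a · x ≈ 0#
  p∣a⇒a·x≈0 (divides q ≡.refl) x = begin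
    (q *ℕ p) · x               ≈⟨ ×-congʳ (q *ℕ p) (*-identityˡ x) ⟨
    (q *ℕ p) · (1# * x)        ≈⟨ ×-assoc-* (q *ℕ p) 1# x ⟨
    ((q *ℕ p) · 1#) * x        ≈⟨ *-congʳ (×1-homo-* q p) ⟩
    ((q · 1#) * (p · 1#)) * x  ≈⟨ *-congʳ (*-congˡ p·1≈0) ⟩
    ((q · 1#) * 0#) * x        ≈⟨ *-congʳ (zeroʳ _) ⟩
    0# * x                     ≈⟨ zeroˡ x ⟩
    0#                         ∎

  [x+y]^p≈x^p+y^p : ∀ x y → (x + y) ^ p ≈ x ^ p + y ^ p
  [x+y]^p≈x^p+y^p = freshmans-dream commutativeSemiring p (ℕ.<-trans (s≤s z≤n) (prime>1 p-prime))
    (λ j 0<j j<p → p∣a⇒a·x≈0 (prime∣C p-prime 0<j j<p))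

  frob : ℕ → Carrier → Carrier
  frob e x = x ^ (p ^ℕ e)

  frob-cong : ∀ e {x y} → x ≈ y → frob e x ≈ frob e y
  frob-cong e = ^-congˡ (p ^ℕ e)

  frob-zero : ∀ x → frob 0 x ≈ x
  frob-zero = *-identityʳ

  frob-∘ : ∀ a b x → frob (a ℕ.+ b) x ≈ frob b (frob a x)
  frob-∘ a b x = trans (reflexive (≡.cong (x ^_) (ℕ.^-distribˡ-+-* p a b))) (sym (^-assocʳ x (p ^ℕ a) (p ^ℕ b)))

  frob-+ : ∀ e x y → frob e (x + y) ≈ frob e x + frob e y
  frob-+ zero    x y = trans (frob-zero (x + y)) (sym (+-cong (frob-zero x) (frob-zero y)))
  frob-+ (suc e) x y = begin
    (x + y) ^ (p *ℕ p ^ℕ e)                        ≈⟨ ^-assocʳ (x + y) p (p ^ℕ e) ⟨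
    ((x + y) ^ p) ^ (p ^ℕ e)                       ≈⟨ ^-congˡ (p ^ℕ e) ([x+y]^p≈x^p+y^p x y) ⟩
    (x ^ p + y ^ p) ^ (p ^ℕ e)                     ≈⟨ frob-+ e (x ^ p) (y ^ p) ⟩
    (x ^ p) ^ (p ^ℕ e) + (y ^ p) ^ (p ^ℕ e)        ≈⟨ +-cong (^-assocʳ x p (p ^ℕ e)) (^-assocʳ y p (p ^ℕ e)) ⟩
    x ^ (p *ℕ p ^ℕ e) + y ^ (p *ℕ p ^ℕ e)          ∎

  frob-* : ∀ e x y → frob e (x * y) ≈ frob e x * frob e y
  frob-* e x y = ^-distrib-* x y (p ^ℕ e)

  frob-0# : ∀ e → frob e 0# ≈ 0#
  frob-0# e = x+x≈x⇒x≈0 (frob e 0#) (trans (sym (frob-+ e 0# 0#)) (frob-cong e (+-identityʳ 0#)))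

  frob-‿ : ∀ e x → frob e (- x) ≈ - frob e x
  frob-‿ e x = +-inverseʳ-unique (frob e x) (frob e (- x))
    (trans (sym (frob-+ e x (- x))) (trans (frob-cong e (-‿inverseʳ x)) (frob-0# e)))

  frob-m : ∀ x → frob m x ≈ x
  frob-m x = trans (reflexive (≡.cong (x ^_) p^m≡1+n)) (fermat x)

  frob-*m : ∀ j x → frob (j *ℕ m) x ≈ x
  frob-*m zero    x = frob-zero x
  frob-*m (suc j) x = trans (frob-∘ m (j *ℕ m) x) (trans (frob-*m j (frob m x)) (frob-m x))

  x≈-x⇒x≈0 : ¬ 2 ∣ p → ∀ {x} → x ≈ - x → x ≈ 0#
  x≈-x⇒x≈0 p-odd {x} x≈-x = begin
    x                                ≈⟨ +-identityʳ x ⟨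
    x + 0#                           ≈⟨ +-congˡ (·-zeroʳ (p / 2)) ⟨
    x + (p / 2) · 0#                 ≈⟨ +-congˡ (×-congʳ (p / 2) 2·x≈0) ⟨
    x + (p / 2) · (2 · x)            ≈⟨ +-congˡ (×-assocˡ x (p / 2) 2) ⟩
    x + (p / 2 *ℕ 2) · x             ≡⟨ ≡.cong (_· x) (≡.sym (¬2∣n⇒n≡1+[n/2]*2 p-odd)) ⟩
    p · x                            ≈⟨ p∣a⇒a·x≈0 ∣-refl x ⟩
    0#                               ∎
    where
    ·-zeroʳ : ∀ j → j · 0# ≈ 0#
    ·-zeroʳ zero    = refl
    ·-zeroʳ (suc j) = trans (+-identityˡ _) (·-zeroʳ j)
    2·x≈0 : 2 · x ≈ 0#
    2·x≈0 = trans (+-congˡ (+-identityʳ x)) (trans (+-congˡ x≈-x) (-‿inverseʳ x))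

  module _ {t : Carrier} where
    private
      Fixes Negates : ℕ → Set ℓ
      Fixes e   = frob e t ≈ t
      Negates e = frob e t ≈ - t

    fixes-+ : ∀ {a b} → Fixes a → Fixes b → Fixes (a ℕ.+ b)
    fixes-+ {a} {b} fa fb = trans (frob-∘ a b t) (trans (frob-cong b fa) fb)

    negates-+-fixes : ∀ {a b} → Negates a → Fixes b → Negates (a ℕ.+ b)
    negates-+-fixes {a} {b} na fb = trans (frob-∘ a b t) (trans (frob-cong b na) (trans (frob-‿ b t) (-‿cong fb)))

    negates-+ : ∀ {a b} → Negates a → Negates b → Fixes (a ℕ.+ b)
    negates-+ {a} {b} na nb =
      trans (frob-∘ a b t) (trans (frob-cong b na) (trans (frob-‿ b t) (trans (-‿cong nb) (-‿involutive t))))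

    fixes-* : ∀ {a} → Fixes a → ∀ j → Fixes (j *ℕ a)
    fixes-*     fa zero    = frob-zero t
    fixes-* {a} fa (suc j) = fixes-+ {a} {j *ℕ a} fa (fixes-* fa j)

    negates-odd* : ∀ {a} → Negates a → ∀ h → Negates (suc (h *ℕ 2) *ℕ a)
    negates-odd* {a} na h = ≡.subst Negates (≡.cong (a ℕ.+_) (≡.sym [h*2]*a≡h*[a+a]))
      (negates-+-fixes {a} {h *ℕ (a ℕ.+ a)} na (fixes-* {a ℕ.+ a} (negates-+ {a} {a} na na) h))
      where
      [h*2]*a≡h*[a+a] : h *ℕ 2 *ℕ a ≡ h *ℕ (a ℕ.+ a)
      [h*2]*a≡h*[a+a] = ≡.trans (ℕ.*-assoc h 2 a) (≡.cong (h *ℕ_) (≡.cong (a ℕ.+_) (ℕ.+-identityʳ a)))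

    negates⇒fixes⊎negates-* : ∀ {k} → Negates k → ∀ j → Fixes (j *ℕ k) ⊎ Negates (j *ℕ k)
    negates⇒fixes⊎negates-* nk zero = inj₁ (frob-zero t)
    negates⇒fixes⊎negates-* {k} nk (suc j) with negates⇒fixes⊎negates-* nk j
    ... | inj₁ fjk = inj₂ (negates-+-fixes {k} {j *ℕ k} nk fjk)
    ... | inj₂ njk = inj₁ (negates-+ {k} {j *ℕ k} nk njk)

    negates⇒fixes⊎negates-gcd : ∀ {k} → Negates k → Fixes (gcd k m) ⊎ Negates (gcd k m)
    negates⇒fixes⊎negates-gcd {k} nk with Bézout.lemma k m
    ... | Bézout.result d gcd[d] identity = ≡.subst (λ e → Fixes e ⊎ Negates e)
            (GCD.unique gcd[d] (gcd-GCD k m)) (from-identity identity)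
      where
      from-identity : Bézout.Identity d k m → Fixes d ⊎ Negates d
      from-identity (Bézout.+- x y d+ym≡xk) = map (trans frob-d≈frob-xk) (trans frob-d≈frob-xk) (negates⇒fixes⊎negates-* nk x)
        where
        frob-d≈frob-xk : frob d t ≈ frob (x *ℕ k) t
        frob-d≈frob-xk = begin
          frob d t                  ≈⟨ frob-*m y (frob d t) ⟨
          frob (y *ℕ m) (frob d t)  ≈⟨ frob-∘ d (y *ℕ m) t ⟨
          frob (d ℕ.+ y *ℕ m) t     ≡⟨ ≡.cong (λ e → frob e t) d+ym≡xk ⟩
          frob (x *ℕ k) t           ∎
      from-identity (Bézout.-+ x y d+xk≡ym) = map
        (λ fxk → sym (trans t≈frob-d[frob-xk] (frob-cong d fxk)))
        (λ nxk → sym (trans (-‿cong (trans t≈frob-d[frob-xk] (trans (frob-cong d nxk) (frob-‿ d t))))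
                            (-‿involutive _)))
        (negates⇒fixes⊎negates-* nk x)
        where
        t≈frob-d[frob-xk] : t ≈ frob d (frob (x *ℕ k) t)
        t≈frob-d[frob-xk] = begin
          t                           ≈⟨ frob-*m y t ⟨
          frob (y *ℕ m) t             ≡⟨ ≡.cong (λ e → frob e t) (≡.trans (≡.sym d+xk≡ym) (ℕ.+-comm d (x *ℕ k))) ⟩
          frob (x *ℕ k ℕ.+ d) t       ≈⟨ frob-∘ (x *ℕ k) d t ⟩
          frob d (frob (x *ℕ k) t)    ∎

    anti-fixed⇒≈0 : ¬ 2 ∣ p → ∀ k {d} → gcd k m *ℕ d ≡ m → ¬ 2 ∣ d → frob k t ≈ - t → t ≈ 0#
    anti-fixed⇒≈0 p-odd k {d} g*d≡m d-odd nk = x≈-x⇒x≈0 p-odd t≈-t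
      where
      g : ℕ
      g = gcd k m
      m≡odd*g : suc (d / 2 *ℕ 2) *ℕ g ≡ m
      m≡odd*g = ≡.trans (≡.cong (_*ℕ g) (≡.sym (¬2∣n⇒n≡1+[n/2]*2 d-odd))) (≡.trans (ℕ.*-comm d g) g*d≡m)
      t≈-t : t ≈ - t
      t≈-t with negates⇒fixes⊎negates-gcd {k} nk | gcd[m,n]∣m k m
      ... | inj₁ fg | divides e k≡e*g = trans (sym (≡.subst Fixes (≡.sym k≡e*g) (fixes-* {g} fg e))) nk
      ... | inj₂ ng | _               = trans (sym (frob-m t)) (≡.subst Negates m≡odd*g (negates-odd* {g} ng (d / 2)))

  twist : ℕ → Carrier → Carrier → Carrier
  twist k a v = frob k a * v + a * frob k v

  twist-cong : ∀ k a {v w} → v ≈ w → twist k a v ≈ twist k a w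
  twist-cong k a v≈w = +-cong (*-congˡ v≈w) (*-congˡ (frob-cong k v≈w))

  twist-[a*s] : ∀ k a s → twist k a (a * s) ≈ (a * frob k a) * (s + frob k s)
  twist-[a*s] k a s = begin
    frob k a * (a * s) + a * frob k (a * s)          ≈⟨ +-congˡ (*-congˡ (frob-* k a s)) ⟩
    frob k a * (a * s) + a * (frob k a * frob k s)   ≈⟨ +-cong (x∙yz≈yx∙z _ _ _) (sym (*-assoc _ _ _)) ⟩
    (a * frob k a) * s + (a * frob k a) * frob k s   ≈⟨ distribˡ _ _ _ ⟨
    (a * frob k a) * (s + frob k s)                  ∎

  twist-‿ : ∀ k a v w → twist k a (v - w) ≈ twist k a v - twist k a w
  twist-‿ k a v w = begin
    frob k a * (v - w) + a * frob k (v - w)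
      ≈⟨ +-congˡ (*-congˡ (trans (frob-+ k v (- w)) (+-congˡ (frob-‿ k w)))) ⟩
    frob k a * (v - w) + a * (frob k v - frob k w)
      ≈⟨ +-cong (x[y-z]≈xy-xz _ _ _) (x[y-z]≈xy-xz _ _ _) ⟩
    (frob k a * v - frob k a * w) + (a * frob k v - a * frob k w)
      ≈⟨ interchange _ _ _ _ ⟩
    twist k a v + (- (frob k a * w) - a * frob k w)
      ≈⟨ +-congˡ (-‿+-comm _ _) ⟩
    twist k a v - twist k a w
      ∎

  module _ (p-odd : ¬ 2 ∣ p) (k : ℕ) {d : ℕ} (g*d≡m : gcd k m *ℕ d ≡ m) (d-odd : ¬ 2 ∣ d) {a : Carrier} (a≉0 : a ≉ 0#) where

    twist-kernel : ∀ {v} → twist k a v ≈ 0# → v ≈ 0#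
    twist-kernel {v} twist≈0 = begin
      v            ≈⟨ x*[x⁻¹*y]≈y a≉0 v ⟨
      a * s        ≈⟨ *-congˡ (anti-fixed⇒≈0 p-odd k g*d≡m d-odd frob-s≈-s) ⟩
      a * 0#       ≈⟨ zeroʳ a ⟩
      0#           ∎
      where
      s : Carrier
      s = inverse a a≉0 * v
      s+frob-s≈0 : s + frob k s ≈ 0#
      s+frob-s≈0 = *-cancelˡ (*-nonzero a≉0 (^-nonzero a≉0 (p ^ℕ k))) (begin
        (a * frob k a) * (s + frob k s)   ≈⟨ twist-[a*s] k a s ⟨
        twist k a (a * s)                 ≈⟨ twist-cong k a (x*[x⁻¹*y]≈y a≉0 v) ⟩
        twist k a v                       ≈⟨ twist≈0 ⟩
        0#                                ≈⟨ zeroʳ _ ⟨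
        (a * frob k a) * 0#               ∎)
      frob-s≈-s : frob k s ≈ - s
      frob-s≈-s = +-inverseʳ-unique s (frob k s) s+frob-s≈0

    twist-injective : ∀ {v w} → twist k a v ≈ twist k a w → v ≈ w
    twist-injective {v} {w} eq = x∙y⁻¹≈ε⇒x≈y v w (twist-kernel (trans (twist-‿ k a v w) (x≈y⇒x∙y⁻¹≈ε eq)))

open import Defs using (_^_)

lemma4p2 : ∀ {c ℓ} (p m k : ℕ) → Prime p → ¬ (2 ∣ p) → 1 ≤ m
    → 1 ≤ k → k < m → (∃ λ d → gcd k m *ℕ d ≡ m × ¬ (2 ∣ d))
    → (M : CommutativeRing c ℓ) → IsField M → HasCard M (p ^ℕ m)
    → let open CommutativeRing M in
    (f g : Carrier → Carrier) → IsFpLinear M f → IsFpLinear M g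
    → (u : Carrier → Carrier) → (∀ {w w′} → w ≈ w′ → u w ≈ u w′)
    → (∀ w x → f (_^_ M x (p ^ℕ k) * u w + x * _^_ M (u w) (p ^ℕ k))
    ≈ _^_ M (g x) (p ^ℕ k) * w + g x * _^_ M w (p ^ℕ k))
    → Bijective _≈_ _≈_ u ⊎ (∀ x → g x ≈ 0#)
lemma4p2 p m k p-prime p-odd _ _ _ (d , g*d≡m , d-odd) M isField card f g f-linear g-linear u u-cong u-spec =
  map₁ bijective (∃-nonzero⊎zero g (proj₁ g-linear))
  where
  open CommutativeRing M
  p^m≡1+n : p ^ℕ m ≡ suc (ℕ.pred (p ^ℕ m))
  p^m≡1+n = ≡.sym (ℕ.suc-pred (p ^ℕ m) ⦃ Fin.nonZeroIndex (Bijection.to card 0#) ⦄)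
  card′ : HasCard M (suc (ℕ.pred (p ^ℕ m)))
  card′ = ≡.subst (HasCard M) p^m≡1+n card
  open FiniteFieldProperties M isField card′
  open Frobenius M isField card′ p-prime m p^m≡1+n
  bijective : ∃ (λ x → g x ≉ 0#) → Bijective _≈_ _≈_ u
  bijective (x , gx≉0) = injective⇒bijective u u-cong λ {w} {w′} uw≈uw′ →
    twist-injective p-odd k g*d≡m d-odd gx≉0 (begin
      twist k (g x) w           ≈⟨ u-spec w x ⟨
      f (twist k x (u w))       ≈⟨ proj₁ f-linear (twist-cong k x uw≈uw′) ⟩
      f (twist k x (u w′))      ≈⟨ u-spec w′ x ⟩
      twist k (g x) w′          ∎)
    where open import Relation.Binary.Reasoning.Setoid setoid
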